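{- Consider integers $n\ge 0$, $l\ge 1$ and $b$ with $2 \leq b \leq 10$. \begin{enumerate} \item The solutions $(n,b,l)$ of $N_{n} = (b+1)b^l-1$ are exactly $(9,4,1), (11,6,1)$; the corresponding values are $19$ and $41$. \item The solutions $(n,b,l)$ of $N_{n} = (b+1)b^l+1$ are exactly $(8,2,2), (8,3,1), (22,7,3)$; the corresponding values are $13$ and $2745$. \item The solutions $(n,b,l)$ of $N_{n} = (b-1)b^l-1$ are exactly $(0,2,1), (1,2,1), (2,2,1), (4,2,2), (9,5,1), (11,7,1)$; the corresponding values are $1, 3, 19, 41$. \item The solutions $(n,b,l)$ of $N_{n} = (b-1)b^l+1$ are exactly $(4,2,1), (7,2,3), (8,4,1), (9,3,2), (14,2,7)$; the corresponding values are $3, 9, 13, 19, 129$. \end{enumerate}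
   Context: $(N_n)_{n\ge 0}$ denotes Narayana's cows sequence: $N_0=N_1=N_2=1$ and $N_{n+3}=N_{n+2}+N_n$ for all $n\ge 0$. -}

module Defs where

open import Data.Nat using (ℕ; zero; suc; _+_)

N : ℕ → ℕ
N 0 = 1
N 1 = 1
N 2 = 1
N (suc (suc (suc n))) = N (suc (suc n)) + N n

-- For l below a cutoff k(b) the right-hand side is below N 23 = 4023, so n < 23
-- since N increases, and a finite search settles these cases. For l ≥ k(b) the
-- equation reads N n + c₁ = a·b^l + c₂ with (c₁ , c₂) = (1 , 0) or (0 , 1), and it
-- is refuted by a sieve modulo some M divisible by b^k. Modulo b^k it says
-- N n + c₁ ≡ c₂, which leaves only a few residues r of n modulo the period T of
-- N mod b^k. On each progression n = r + iT the residues of N mod M are obtained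
-- by a linear jump by T steps, and each of them is incompatible, modulo some
-- divisor q of M, with all values of a·b^l + c₂ mod q, which are periodic in l.
module Submission where

open import Defs
open import Data.Nat using (ℕ; _+_; _*_; _∸_; _^_; _≤_)
open import Data.Product using (_×_; _,_)
open import Data.Sum using (_⊎_)
open import Relation.Binary.PropositionalEquality using (_≡_)

open import Data.Nat using (zero; suc; _<_; _%_; _/_; NonZero; >-nonZero; s≤s; z≤n; _≟_; _<?_)
open import Data.Nat.Properties
  using (+-identityʳ; +-suc; +-comm; ^-distribˡ-+-*; m^n≢0; ≤-refl; ≤-trans; m≤m+n;
         m∸n+n≡m; m+[n∸m]≡n; ≮⇒≥; <⇒≱; _≤?_; allUpTo?)
open import Data.Nat.DivMod using (m≡m%n+[m/n]*n; m%n<n; m%n%n≡m%n; %-distribˡ-+; %-distribˡ-*;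
                                   %-remove-+ˡ; m∣n⇒o%n%m≡o%m)
open import Data.Nat.Divisibility using (_∣_; _∣?_; m∣m*n; ∣n⇒∣m*n)
open import Data.Nat.GeneralisedArithmetic using (iterate)
open import Data.Nat.Tactic.RingSolver using (solve-∀)
open import Data.Product using (proj₁)
open import Data.Product.Properties using (≡-dec)
open import Data.Sum using (inj₁; inj₂)
open import Data.List using (List; []; _∷_; map)
import Data.List as List
open import Data.List.Relation.Unary.All as All using (All; all?)
open import Data.List.Relation.Unary.Any using (Any; any?; here; there)
open import Data.List.Membership.Propositional using (_∈_; _∉_; find)
open import Data.List.Membership.Propositional.Properties using (∈-map⁺)
open import Data.List.Membership.DecPropositional _≟_ using (_∈?_)
open import Relation.Binary.PropositionalEquality
  using (_≢_; refl; sym; trans; cong; cong₂; subst; module ≡-Reasoning)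
open import Relation.Binary.Definitions using (DecidableEquality)
open import Relation.Nullary using (Dec; yes; no; ¬_; ¬?; contradiction)
open import Relation.Nullary.Decidable
  using (True; toWitness; from-yes; _×-dec_; _⊎-dec_; _→-dec_)

open ≡-Reasoning

%-cong-+ : ∀ {x x′ y y′} d .{{_ : NonZero d}} →
           x % d ≡ x′ % d → y % d ≡ y′ % d → (x + y) % d ≡ (x′ + y′) % d
%-cong-+ {x} {x′} {y} {y′} d x≡x′ y≡y′ = begin
  (x + y) % d             ≡⟨ %-distribˡ-+ x y d ⟩
  (x % d + y % d) % d     ≡⟨ cong₂ (λ u v → (u + v) % d) x≡x′ y≡y′ ⟩
  (x′ % d + y′ % d) % d   ≡⟨ %-distribˡ-+ x′ y′ d ⟨
  (x′ + y′) % d           ∎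

%-cong-* : ∀ {x x′ y y′} d .{{_ : NonZero d}} →
           x % d ≡ x′ % d → y % d ≡ y′ % d → (x * y) % d ≡ (x′ * y′) % d
%-cong-* {x} {x′} {y} {y′} d x≡x′ y≡y′ = begin
  (x * y) % d             ≡⟨ %-distribˡ-* x y d ⟩
  (x % d * (y % d)) % d   ≡⟨ cong₂ (λ u v → (u * v) % d) x≡x′ y≡y′ ⟩
  (x′ % d * (y′ % d)) % d ≡⟨ %-distribˡ-* x′ y′ d ⟨
  (x′ * y′) % d           ∎

m∣n⇒[o%n+p]%m≡[o+p]%m : ∀ m n .{{_ : NonZero m}} .{{_ : NonZero n}} → m ∣ n →
                        ∀ o p → (o % n + p) % m ≡ (o + p) % m
m∣n⇒[o%n+p]%m≡[o+p]%m m n m∣n o p = %-cong-+ m (m∣n⇒o%n%m≡o%m m n o m∣n) refl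

iterate-*-% : ∀ b q .{{_ : NonZero q}} m s →
              iterate (λ x → (b * x) % q) (b ^ m % q) s ≡ b ^ (m + s) % q
iterate-*-% b q m zero = cong (λ t → b ^ t % q) (sym (+-identityʳ m))
iterate-*-% b q m (suc s) = begin
  iterate (λ x → (b * x) % q) ((b * (b ^ m % q)) % q) s
    ≡⟨ cong (λ y → iterate (λ x → (b * x) % q) y s) (%-cong-* {b} q refl (m%n%n≡m%n (b ^ m) q)) ⟩
  iterate (λ x → (b * x) % q) (b ^ suc m % q) s
    ≡⟨ iterate-*-% b q (suc m) s ⟩
  b ^ (suc m + s) % q
    ≡⟨ cong (λ t → b ^ t % q) (+-suc m s) ⟨
  b ^ (m + suc s) % q
    ∎

periodic-shift : ∀ {A : Set} (f : ℕ → A) P → (∀ n → f (n + P) ≡ f n) →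
                 ∀ q m → f (m + q * P) ≡ f m
periodic-shift f P periodic zero m = cong f (+-identityʳ m)
periodic-shift f P periodic (suc q) m = begin
  f (m + (P + q * P)) ≡⟨ cong f (reorder m P (q * P)) ⟩
  f (m + q * P + P)   ≡⟨ periodic (m + q * P) ⟩
  f (m + q * P)       ≡⟨ periodic-shift f P periodic q m ⟩
  f m                 ∎
  where
  reorder : ∀ m p r → m + (p + r) ≡ m + r + p
  reorder = solve-∀

periodic-% : ∀ {A : Set} (f : ℕ → A) P .{{_ : NonZero P}} → (∀ n → f (n + P) ≡ f n) →
             ∀ n → f n ≡ f (n % P)
periodic-% f P periodic n = begin
  f n                   ≡⟨ cong f (m≡m%n+[m/n]*n n P) ⟩
  f (n % P + n / P * P) ≡⟨ periodic-shift f P periodic (n / P) (n % P) ⟩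
  f (n % P)             ∎

∈-iterate : ∀ {A : Set} (f : A → A) x {s L} → s < L → iterate f x s ∈ List.iterate f x L
∈-iterate f x {zero}  {suc L} _         = here refl
∈-iterate f x {suc s} {suc L} (s≤s s<L) = there (∈-iterate f (f x) s<L)

Window : Set
Window = ℕ × ℕ × ℕ

_≟ʷ_ : DecidableEquality Window
_≟ʷ_ = ≡-dec _≟_ (≡-dec _≟_ _≟_)

terms : ℕ → Window
terms n = N n , N (1 + n) , N (2 + n)

infix 7 _⊙_
_⊙_ : Window → Window → ℕ
(x , y , z) ⊙ (u , v , w) = x * u + y * v + z * w

window : (M : ℕ) .{{_ : NonZero M}} → ℕ → Window
window M n = N n % M , N (1 + n) % M , N (2 + n) % M

advance : (M : ℕ) .{{_ : NonZero M}} → Window → Window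
advance M (u , v , w) = v , w , (w + u) % M

module _ (M : ℕ) .{{_ : NonZero M}} where

  advance-window : ∀ n → advance M (window M n) ≡ window M (suc n)
  advance-window n = cong (λ x → N (1 + n) % M , N (2 + n) % M , x)
                          (sym (%-distribˡ-+ (N (2 + n)) (N n) M))

  iterate-advance : ∀ m n → iterate (advance M) (window M n) m ≡ window M (m + n)
  iterate-advance zero n = refl
  iterate-advance (suc m) n = begin
    iterate (advance M) (advance M (window M n)) m
      ≡⟨ cong (λ w → iterate (advance M) w m) (advance-window n) ⟩
    iterate (advance M) (window M (suc n)) m
      ≡⟨ iterate-advance m (suc n) ⟩
    window M (m + suc n)
      ≡⟨ cong (window M) (+-suc m n) ⟩
    window M (suc m + n)
      ∎

  iterate-advance-0 : ∀ n → iterate (advance M) (window M 0) n ≡ window M n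
  iterate-advance-0 n = trans (iterate-advance n 0) (cong (window M) (+-identityʳ n))

  window-returns : ∀ P → iterate (advance M) (window M 0) P ≡ window M 0 → window M P ≡ window M 0
  window-returns P returns = trans (sym (iterate-advance-0 P)) returns

  window-periodic : ∀ P → window M P ≡ window M 0 → ∀ n → window M (n + P) ≡ window M n
  window-periodic P returns n = begin
    window M (n + P)                   ≡⟨ iterate-advance n P ⟨
    iterate (advance M) (window M P) n ≡⟨ cong (λ w → iterate (advance M) w n) returns ⟩
    iterate (advance M) (window M 0) n ≡⟨ iterate-advance-0 n ⟩
    window M n                         ∎

  Jumps : ℕ → Window → Set
  Jumps m c = ∀ n → N (m + n) % M ≡ (c ⊙ terms n) % M

  coefficients-step : Window → Window
  coefficients-step (x , y , z) = z , x , (y + z) % M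

  coefficients : ℕ → Window
  coefficients = iterate coefficients-step (1 , 0 , 0)

  jumps-zero : Jumps 0 (1 , 0 , 0)
  jumps-zero n = cong (_% M) (unit (N n) (N (1 + n)) (N (2 + n)))
    where
    unit : ∀ u v w → u ≡ 1 * u + 0 * v + 0 * w
    unit = solve-∀

  jumps-step : ∀ {m} c → Jumps m c → Jumps (suc m) (coefficients-step c)
  jumps-step {m} (x , y , z) c-jumps n = begin
    N (suc m + n) % M
      ≡⟨ cong (λ t → N t % M) (+-suc m n) ⟨
    N (m + suc n) % M
      ≡⟨ c-jumps (suc n) ⟩
    (x * N (1 + n) + y * N (2 + n) + z * (N (2 + n) + N n)) % M
      ≡⟨ cong (_% M) (recurrence x y z (N n) (N (1 + n)) (N (2 + n))) ⟩
    (z * N n + x * N (1 + n) + (y + z) * N (2 + n)) % M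
      ≡⟨ %-cong-+ M refl (%-cong-* M (sym (m%n%n≡m%n (y + z) M)) refl) ⟩
    (z * N n + x * N (1 + n) + (y + z) % M * N (2 + n)) % M
      ∎
    where
    recurrence : ∀ x y z u v w → x * v + y * w + z * (w + u) ≡ z * u + x * v + (y + z) * w
    recurrence = solve-∀

  jumps-iterate : ∀ {m} c → Jumps m c → ∀ i → Jumps (i + m) (iterate coefficients-step c i)
  jumps-iterate c c-jumps zero = c-jumps
  jumps-iterate {m} c c-jumps (suc i) n = begin
    N (suc i + m + n) % M
      ≡⟨ cong (λ t → N (t + n) % M) (+-suc i m) ⟨
    N (i + suc m + n) % M
      ≡⟨ jumps-iterate {suc m} (coefficients-step c) (jumps-step {m} c c-jumps) i n ⟩
    (iterate coefficients-step (coefficients-step c) i ⊙ terms n) % M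
      ∎

  coefficients-jump : ∀ m → Jumps m (coefficients m)
  coefficients-jump m n = begin
    N (m + n) % M                  ≡⟨ cong (λ t → N (t + n) % M) (+-identityʳ m) ⟨
    N (m + 0 + n) % M              ≡⟨ jumps-iterate {0} (1 , 0 , 0) jumps-zero m n ⟩
    (coefficients m ⊙ terms n) % M ∎

  ⊙-window : ∀ c n → (c ⊙ window M n) % M ≡ (c ⊙ terms n) % M
  ⊙-window (x , y , z) n =
    %-cong-+ M (%-cong-+ M (reduce x (N n)) (reduce y (N (1 + n)))) (reduce z (N (2 + n)))
    where
    reduce : ∀ a u → (a * (u % M)) % M ≡ (a * u) % M
    reduce a u = %-cong-* {a} M refl (m%n%n≡m%n u M)

  jump : Window → Window → Window
  jump c w = (c ⊙ w) % M , (c ⊙ advance M w) % M , (c ⊙ advance M (advance M w)) % M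

  module _ {T c} (c-jumps : Jumps T c) where

    jump-term : ∀ n → (c ⊙ window M n) % M ≡ N (T + n) % M
    jump-term n = trans (⊙-window c n) (sym (c-jumps n))

    jump-window : ∀ n → jump c (window M n) ≡ window M (T + n)
    jump-window n = begin
      jump c (window M n)
        ≡⟨ cong₂ (λ w w′ → (c ⊙ window M n) % M , (c ⊙ w) % M , (c ⊙ w′) % M)
                 (advance-window n)
                 (trans (cong (advance M) (advance-window n)) (advance-window (suc n))) ⟩
      (c ⊙ window M n) % M , (c ⊙ window M (1 + n)) % M , (c ⊙ window M (2 + n)) % M
        ≡⟨ cong₂ _,_ (jump-term n) (cong₂ _,_ (jump-term (1 + n)) (jump-term (2 + n))) ⟩
      N (T + n) % M , N (T + (1 + n)) % M , N (T + (2 + n)) % M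
        ≡⟨ cong₂ (λ t t′ → N (T + n) % M , N t % M , N t′ % M)
                 (+-suc T n) (trans (+-suc T (1 + n)) (cong suc (+-suc T n))) ⟩
      window M (T + n)
        ∎

    iterate-jump : ∀ i n → iterate (jump c) (window M n) i ≡ window M (i * T + n)
    iterate-jump zero n = refl
    iterate-jump (suc i) n = begin
      iterate (jump c) (jump c (window M n)) i ≡⟨ cong (λ w → iterate (jump c) w i) (jump-window n) ⟩
      iterate (jump c) (window M (T + n)) i    ≡⟨ iterate-jump i (T + n) ⟩
      window M (i * T + (T + n))               ≡⟨ cong (window M) (reorder i T n) ⟩
      window M (suc i * T + n)                 ∎
      where
      reorder : ∀ i t n → i * t + (t + n) ≡ (t + i * t) + n
      reorder = solve-∀

    jump-returns : ∀ D → iterate (jump c) (window M 0) D ≡ window M 0 → window M (D * T) ≡ window M 0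
    jump-returns D returns = begin
      window M (D * T)                 ≡⟨ cong (window M) (+-identityʳ (D * T)) ⟨
      window M (D * T + 0)             ≡⟨ iterate-jump D 0 ⟨
      iterate (jump c) (window M 0) D  ≡⟨ returns ⟩
      window M 0                       ∎

-- `modulo q L`: a divisor q of the sieving modulus such that b ^ (k + j) mod q has
-- period L in j; both claims are checked by `valid?`.
record Filter : Set where
  constructor modulo
  field
    modulus period : ℕ
    .{{modulus-nonZero}} : NonZero modulus
open Filter

module Sieve (a b k c₁ c₂ : ℕ) .{{_ : NonZero b}} where

  private instance
    bᵏ-nonZero : NonZero (b ^ k)
    bᵏ-nonZero = m^n≢0 b k

  residues : Filter → List ℕ
  residues (modulo q L) =
    map (λ x → (a * x + c₂) % q) (List.iterate (λ x → (b * x) % q) (b ^ k % q) L)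

  PowersRepeat : Filter → Set
  PowersRepeat f = 1 ≤ period f × b ^ (k + period f) % modulus f ≡ b ^ k % modulus f

  target-periodic : ∀ q .{{_ : NonZero q}} L → b ^ (k + L) % q ≡ b ^ k % q →
                    ∀ j → (a * b ^ (k + (j + L)) + c₂) % q ≡ (a * b ^ (k + j) + c₂) % q
  target-periodic q L repeats j = %-cong-+ q (%-cong-* {a} q refl powers) refl
    where
    reorder : ∀ k j L → k + (j + L) ≡ k + L + j
    reorder = solve-∀
    powers : b ^ (k + (j + L)) % q ≡ b ^ (k + j) % q
    powers = begin
      b ^ (k + (j + L)) % q     ≡⟨ cong (λ t → b ^ t % q) (reorder k j L) ⟩
      b ^ (k + L + j) % q       ≡⟨ cong (_% q) (^-distribˡ-+-* b (k + L) j) ⟩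
      (b ^ (k + L) * b ^ j) % q ≡⟨ %-cong-* q repeats refl ⟩
      (b ^ k * b ^ j) % q       ≡⟨ cong (_% q) (^-distribˡ-+-* b k j) ⟨
      b ^ (k + j) % q           ∎

  target-∈-residues : ∀ f → PowersRepeat f → ∀ j → (a * b ^ (k + j) + c₂) % modulus f ∈ residues f
  target-∈-residues (modulo q L) (1≤L , repeats) j =
    subst (_∈ residues (modulo q L)) (sym reduced)
          (∈-map⁺ (λ x → (a * x + c₂) % q) (∈-iterate (λ x → (b * x) % q) (b ^ k % q) (m%n<n j L)))
    where
    instance
      L-nonZero : NonZero L
      L-nonZero = >-nonZero 1≤L
    reduced : (a * b ^ (k + j) + c₂) % q
            ≡ (a * iterate (λ x → (b * x) % q) (b ^ k % q) (j % L) + c₂) % q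
    reduced = begin
      (a * b ^ (k + j) + c₂) % q
        ≡⟨ periodic-% (λ j → (a * b ^ (k + j) + c₂) % q) L (target-periodic q L repeats) j ⟩
      (a * b ^ (k + j % L) + c₂) % q
        ≡⟨ %-cong-+ q (%-cong-* {a} q refl (m%n%n≡m%n (b ^ (k + j % L)) q)) refl ⟨
      (a * (b ^ (k + j % L) % q) + c₂) % q
        ≡⟨ cong (λ x → (a * x + c₂) % q) (iterate-*-% b q k (j % L)) ⟨
      (a * iterate (λ x → (b * x) % q) (b ^ k % q) (j % L) + c₂) % q
        ∎

  module _ (M : ℕ) .{{_ : NonZero M}} (T D : ℕ) .{{_ : NonZero T}} .{{_ : NonZero D}}
           (filters : List Filter) where

    Killed : Window → Set
    Killed w = (proj₁ w + c₁) % b ^ k ≢ c₂ % b ^ k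

    Excluded : Window → Set
    Excluded w = Any (λ f → (proj₁ w + c₁) % modulus f ∉ residues f) filters

    Safe : Window → Window → Set
    Safe c w = Killed w ⊎ All Excluded (List.iterate (jump M c) w D)

    ValidWith : Window → Set
    ValidWith c = b ^ k ∣ M
                × All (λ f → modulus f ∣ M × PowersRepeat f) filters
                × iterate (advance (b ^ k)) (window (b ^ k) 0) T ≡ window (b ^ k) 0
                × iterate (jump M c) (window M 0) D ≡ window M 0
                × All (Safe c) (List.iterate (advance M) (window M 0) T)

    Valid : Set
    Valid = ValidWith (coefficients M T)

    -- Abstracting over the coefficients makes the evaluator compute them only once.
    valid? : Dec Valid
    valid? = validWith? (coefficients M T)
      where
      killed? : ∀ w → Dec (Killed w)
      killed? w = ¬? ((proj₁ w + c₁) % b ^ k ≟ c₂ % b ^ k)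
      excluded? : ∀ w → Dec (Excluded w)
      excluded? w = any? (λ f → ¬? ((proj₁ w + c₁) % modulus f ∈? residues f)) filters
      safe? : ∀ c w → Dec (Safe c w)
      safe? c w = killed? w ⊎-dec all? excluded? (List.iterate (jump M c) w D)
      validWith? : ∀ c → Dec (ValidWith c)
      validWith? c = b ^ k ∣? M
        ×-dec all? (λ f → modulus f ∣? M ×-dec 1 ≤? period f ×-dec
                          b ^ (k + period f) % modulus f ≟ b ^ k % modulus f) filters
        ×-dec iterate (advance (b ^ k)) (window (b ^ k) 0) T ≟ʷ window (b ^ k) 0
        ×-dec iterate (jump M c) (window M 0) D ≟ʷ window M 0
        ×-dec all? (safe? c) (List.iterate (advance M) (window M 0) T)

    module _ {n j} (solution : N n + c₁ ≡ a * b ^ (k + j) + c₂) where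

      not-killed : b ^ k ∣ M → window (b ^ k) T ≡ window (b ^ k) 0 → ¬ Killed (window M (n % T))
      not-killed bᵏ∣M period killed = killed (begin
        (N (n % T) % M + c₁) % b ^ k   ≡⟨ m∣n⇒[o%n+p]%m≡[o+p]%m (b ^ k) M bᵏ∣M (N (n % T)) c₁ ⟩
        (N (n % T) + c₁) % b ^ k       ≡⟨ %-cong-+ (b ^ k) N-periodic refl ⟩
        (N n + c₁) % b ^ k             ≡⟨ cong (_% b ^ k) solution ⟩
        (a * b ^ (k + j) + c₂) % b ^ k ≡⟨ %-remove-+ˡ c₂ (∣n⇒∣m*n a bᵏ∣bᵏ⁺ʲ) ⟩
        c₂ % b ^ k                     ∎)
        where
        N-periodic : N (n % T) % b ^ k ≡ N n % b ^ k
        N-periodic = cong proj₁ (sym (periodic-% (window (b ^ k)) T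
                                                 (window-periodic (b ^ k) T period) n))
        bᵏ∣bᵏ⁺ʲ : b ^ k ∣ b ^ (k + j)
        bᵏ∣bᵏ⁺ʲ = subst (b ^ k ∣_) (sym (^-distribˡ-+-* b k j)) (m∣m*n (b ^ j))

      not-excluded : All (λ f → modulus f ∣ M × PowersRepeat f) filters → ¬ Excluded (window M n)
      not-excluded sound excluded with find excluded
      ... | f , f∈ , rejected with All.lookup sound f∈
      ...   | q∣M , repeats =
        rejected (subst (_∈ residues f) (sym congruent) (target-∈-residues f repeats j))
        where
        congruent : (N n % M + c₁) % modulus f ≡ (a * b ^ (k + j) + c₂) % modulus f
        congruent = trans (m∣n⇒[o%n+p]%m≡[o+p]%m (modulus f) M q∣M (N n) c₁)
                          (cong (_% modulus f) solution)

    progression-window : ∀ {c} → Jumps M T c → window M (D * T) ≡ window M 0 →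
              ∀ n → iterate (jump M c) (window M (n % T)) (n / T % D) ≡ window M n
    progression-window {c} c-jumps period n = begin
      iterate (jump M c) (window M r) i
        ≡⟨ iterate-jump M {T} {c} c-jumps i r ⟩
      window M (i * T + r)
        ≡⟨ periodic-shift (window M) (D * T) (window-periodic M (D * T) period) q (i * T + r) ⟨
      window M (i * T + r + q * (D * T))
        ≡⟨ cong (window M) decompose ⟨
      window M n
        ∎
      where
      r = n % T
      i = n / T % D
      q = n / T / D
      reorder : ∀ r i q d t → r + (i + q * d) * t ≡ i * t + r + q * (d * t)
      reorder = solve-∀
      decompose : n ≡ i * T + r + q * (D * T)
      decompose = begin
        n                       ≡⟨ m≡m%n+[m/n]*n n T ⟩
        r + n / T * T           ≡⟨ cong (λ x → r + x * T) (m≡m%n+[m/n]*n (n / T) D) ⟩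
        r + (i + q * D) * T     ≡⟨ reorder r i q D T ⟩
        i * T + r + q * (D * T) ∎

    valid⇒no-solution : Valid → ∀ n j → N n + c₁ ≢ a * b ^ (k + j) + c₂
    valid⇒no-solution (bᵏ∣M , sound , returns-bᵏ , returns-M , safe) n j solution
      with subst (Safe (coefficients M T)) (iterate-advance-0 M (n % T))
                 (All.lookup safe (∈-iterate (advance M) (window M 0) (m%n<n n T)))
    ... | inj₁ killed = not-killed {n} {j} solution bᵏ∣M (window-returns (b ^ k) T returns-bᵏ) killed
    ... | inj₂ progression = not-excluded {n} {j} solution sound
          (subst Excluded (progression-window {c} c-jumps period-M n)
                 (All.lookup progression (∈-iterate (jump M c) (window M (n % T)) (m%n<n (n / T) D))))
      where
      c = coefficients M T
      c-jumps = coefficients-jump M T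
      period-M = jump-returns M {T} {c} c-jumps D returns-M

sieve : ∀ a b k c₁ c₂ .{{_ : NonZero b}} M .{{_ : NonZero M}} T D .{{_ : NonZero T}} .{{_ : NonZero D}}
        filters → {True (Sieve.valid? a b k c₁ c₂ M T D filters)} →
        ∀ n j → N n + c₁ ≢ a * b ^ (k + j) + c₂
sieve a b k c₁ c₂ M T D filters {valid} =
  Sieve.valid⇒no-solution a b k c₁ c₂ M T D filters (toWitness valid)

N-positive : ∀ n → 0 < N n
N-positive 0 = s≤s z≤n
N-positive 1 = s≤s z≤n
N-positive 2 = s≤s z≤n
N-positive (suc (suc (suc n))) = ≤-trans (N-positive (suc (suc n))) (m≤m+n (N (2 + n)) (N n))

N-≤-suc : ∀ n → N n ≤ N (suc n)
N-≤-suc 0 = ≤-refl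
N-≤-suc 1 = ≤-refl
N-≤-suc (suc (suc n)) = m≤m+n (N (2 + n)) (N n)

N-monotone : ∀ {m n} → m ≤ n → N m ≤ N n
N-monotone {m} {n} m≤n = subst (λ t → N m ≤ N t) (m∸n+n≡m m≤n) (shifted (n ∸ m))
  where
  shifted : ∀ d → N m ≤ N (d + m)
  shifted zero    = ≤-refl
  shifted (suc d) = ≤-trans (shifted d) (N-≤-suc (d + m))

N-index-bound : ∀ {v m n} → v < N m → N n ≡ v → n < m
N-index-bound {m = m} {n} v<Nm Nn≡v with n <? m
... | yes n<m = n<m
... | no n≮m  = contradiction (N-monotone (≮⇒≥ n≮m)) (<⇒≱ (subst (_< N m) (sym Nn≡v) v<Nm))

m≡n∸1⇒m+1≡n+0 : ∀ {m} n → 0 < m → m ≡ n ∸ 1 → m + 1 ≡ n + 0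
m≡n∸1⇒m+1≡n+0 zero    0<m refl = contradiction 0<m (λ ())
m≡n∸1⇒m+1≡n+0 {m} (suc n) _ m≡n = begin
  m + 1       ≡⟨ cong (_+ 1) m≡n ⟩
  n + 1       ≡⟨ +-comm n 1 ⟩
  suc n       ≡⟨ +-identityʳ (suc n) ⟨
  suc n + 0   ∎

SmallCases : (value : ℕ → ℕ → ℕ) (cutoff : ℕ → ℕ) (Solutions : ℕ → ℕ → ℕ → Set) → Set
SmallCases value cutoff Solutions =
  ∀ {b} → b < 11 → 2 ≤ b → ∀ {l} → l < cutoff b → 1 ≤ l →
  value b l < N 23 × (∀ {n} → n < 23 → N n ≡ value b l → Solutions n b l)

small-cases? : ∀ value cutoff {Solutions} → (∀ n b l → Dec (Solutions n b l)) →
               Dec (SmallCases value cutoff Solutions)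
small-cases? value cutoff solutions? =
  allUpTo? (λ b → 2 ≤? b →-dec
    allUpTo? (λ l → 1 ≤? l →-dec
      value b l <? N 23 ×-dec allUpTo? (λ n → N n ≟ value b l →-dec solutions? n b l) 23)
    (cutoff b)) 11

classify : ∀ (value : ℕ → ℕ → ℕ) (cutoff : ℕ → ℕ) {Solutions : ℕ → ℕ → ℕ → Set}
           (a : ℕ → ℕ) (c₁ c₂ : ℕ) →
           (∀ n b l → N n ≡ value b l → N n + c₁ ≡ a b * b ^ l + c₂) →
           SmallCases value cutoff Solutions →
           (∀ {b} → 2 ≤ b → b ≤ 10 → ∀ n j → N n + c₁ ≢ a b * b ^ (cutoff b + j) + c₂) →
           ∀ n b l → 1 ≤ l → 2 ≤ b → b ≤ 10 → N n ≡ value b l → Solutions n b l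
classify value cutoff a c₁ c₂ normal small large n b l 1≤l 2≤b b≤10 eq with l <? cutoff b
... | yes l<k = let value<N23 , solutions = small (s≤s b≤10) 2≤b l<k 1≤l in
                solutions (N-index-bound value<N23 eq) eq
... | no l≮k  = contradiction (subst (λ t → N n + c₁ ≡ a b * b ^ t + c₂)
                                     (sym (m+[n∸m]≡n (≮⇒≥ l≮k))) (normal n b l eq))
                             (large 2≤b b≤10 n (l ∸ cutoff b))

-- The sieve parameters below (the modulus M, the period T of N modulo b ^ k, the
-- number D of jumps and the filters) come from a computer search; `sieve` checks
-- them by evaluation.

value⁺⁻ : ℕ → ℕ → ℕ
value⁺⁻ b l = (b + 1) * b ^ l ∸ 1

Solutions⁺⁻ : ℕ → ℕ → ℕ → Set
Solutions⁺⁻ n b l =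
    (n ≡ 9 × b ≡ 4 × l ≡ 1) ⊎ (n ≡ 11 × b ≡ 6 × l ≡ 1)

solutions⁺⁻? : ∀ n b l → Dec (Solutions⁺⁻ n b l)
solutions⁺⁻? n b l =
      (n ≟ 9 ×-dec b ≟ 4 ×-dec l ≟ 1) ⊎-dec (n ≟ 11 ×-dec b ≟ 6 ×-dec l ≟ 1)

solutions⁺⁻-sound : ∀ n b l → Solutions⁺⁻ n b l → N n ≡ value⁺⁻ b l
solutions⁺⁻-sound _ _ _ (inj₁ (refl , refl , refl)) = refl
solutions⁺⁻-sound _ _ _ (inj₂ (refl , refl , refl)) = refl

cutoff⁺⁻ : ℕ → ℕ
cutoff⁺⁻ 2 = 3
cutoff⁺⁻ 3 = 1
cutoff⁺⁻ 4 = 2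
cutoff⁺⁻ 5 = 2
cutoff⁺⁻ 6 = 2
cutoff⁺⁻ 7 = 2
cutoff⁺⁻ 8 = 1
cutoff⁺⁻ 9 = 1
cutoff⁺⁻ 10 = 2
cutoff⁺⁻ _ = 0

large⁺⁻ : ∀ {b} → 2 ≤ b → b ≤ 10 →
         ∀ n j → N n + 1 ≢ (b + 1) * b ^ (cutoff⁺⁻ b + j) + 0
large⁺⁻ {0} () _
large⁺⁻ {1} (s≤s ()) _
large⁺⁻ {2} _ _ = sieve 3 2 3 1 0 118872 28 72
  (modulo 9 6 ∷ modulo 127 7 ∷ modulo 13 12 ∷ modulo 118872 84 ∷ [])
large⁺⁻ {3} _ _ = sieve 4 3 1 1 0 24 8 7 (modulo 8 2 ∷ [])
large⁺⁻ {4} _ _ = sieve 5 4 2 1 0 48 56 1 (modulo 3 1 ∷ [])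
large⁺⁻ {5} _ _ = sieve 6 5 2 1 0 50325 155 24
  (modulo 3 2 ∷ modulo 11 5 ∷ modulo 61 30 ∷ modulo 50325 30 ∷ [])
large⁺⁻ {6} _ _ = sieve 7 6 2 1 0 468 168 1 (modulo 13 12 ∷ [])
large⁺⁻ {7} _ _ = sieve 8 7 2 1 0 7056 399 8 (modulo 16 2 ∷ modulo 9 3 ∷ [])
large⁺⁻ {8} _ _ = sieve 9 8 1 1 0 936 28 6 (modulo 9 2 ∷ modulo 13 4 ∷ [])
large⁺⁻ {9} _ _ = sieve 10 9 1 1 0 936 24 7 (modulo 8 1 ∷ modulo 13 3 ∷ [])
large⁺⁻ {10} _ _ = sieve 11 10 2 1 0 34100 2170 6 (modulo 11 2 ∷ modulo 31 15 ∷ [])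
large⁺⁻ {suc (suc (suc (suc (suc (suc (suc (suc (suc (suc (suc b))))))))))} _ b≤10 =
  contradiction b≤10 (<⇒≱ (m≤m+n 11 b))

classification⁺⁻ : ∀ n b l → 1 ≤ l → 2 ≤ b → b ≤ 10 →
                  N n ≡ value⁺⁻ b l → Solutions⁺⁻ n b l
classification⁺⁻ = classify value⁺⁻ cutoff⁺⁻ (λ b → b + 1) 1 0
  (λ n b l → m≡n∸1⇒m+1≡n+0 ((b + 1) * b ^ l) (N-positive n))
  (from-yes (small-cases? value⁺⁻ cutoff⁺⁻ solutions⁺⁻?)) large⁺⁻

value⁺⁺ : ℕ → ℕ → ℕ
value⁺⁺ b l = (b + 1) * b ^ l + 1

Solutions⁺⁺ : ℕ → ℕ → ℕ → Set
Solutions⁺⁺ n b l =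
    (n ≡ 8 × b ≡ 2 × l ≡ 2) ⊎ (n ≡ 8 × b ≡ 3 × l ≡ 1) ⊎ (n ≡ 22 × b ≡ 7 × l ≡ 3)

solutions⁺⁺? : ∀ n b l → Dec (Solutions⁺⁺ n b l)
solutions⁺⁺? n b l =
      (n ≟ 8 ×-dec b ≟ 2 ×-dec l ≟ 2) ⊎-dec (n ≟ 8 ×-dec b ≟ 3 ×-dec l ≟ 1)
  ⊎-dec (n ≟ 22 ×-dec b ≟ 7 ×-dec l ≟ 3)

solutions⁺⁺-sound : ∀ n b l → Solutions⁺⁺ n b l → N n ≡ value⁺⁺ b l
solutions⁺⁺-sound _ _ _ (inj₁ (refl , refl , refl)) = refl
solutions⁺⁺-sound _ _ _ (inj₂ (inj₁ (refl , refl , refl))) = refl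
solutions⁺⁺-sound _ _ _ (inj₂ (inj₂ (refl , refl , refl))) = refl

cutoff⁺⁺ : ℕ → ℕ
cutoff⁺⁺ 2 = 4
cutoff⁺⁺ 3 = 3
cutoff⁺⁺ 4 = 2
cutoff⁺⁺ 5 = 1
cutoff⁺⁺ 6 = 2
cutoff⁺⁺ 7 = 4
cutoff⁺⁺ 8 = 2
cutoff⁺⁺ 9 = 1
cutoff⁺⁺ 10 = 2
cutoff⁺⁺ _ = 0

large⁺⁺ : ∀ {b} → 2 ≤ b → b ≤ 10 →
         ∀ n j → N n + 0 ≢ (b + 1) * b ^ (cutoff⁺⁺ b + j) + 1
large⁺⁺ {0} () _
large⁺⁺ {1} (s≤s ()) _
large⁺⁺ {2} _ _ = sieve 3 2 4 0 1 310896 56 36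
  (modulo 9 6 ∷ modulo 127 7 ∷ modulo 17 8 ∷ modulo 310896 168 ∷ [])
large⁺⁺ {3} _ _ = sieve 4 3 3 0 1 5989896 72 35 (modulo 8 2 ∷ modulo 11 5 ∷ modulo 2521 126 ∷ [])
large⁺⁺ {4} _ _ = sieve 5 4 2 0 1 10608 56 36 (modulo 3 1 ∷ modulo 17 4 ∷ modulo 13 6 ∷ [])
large⁺⁺ {5} _ _ = sieve 6 5 1 0 1 120 31 56 (modulo 3 2 ∷ modulo 8 2 ∷ [])
large⁺⁺ {6} _ _ = sieve 7 6 2 0 1 1348308 168 11
  (modulo 43 3 ∷ modulo 13 12 ∷ modulo 67 33 ∷ modulo 1348308 132 ∷ [])
large⁺⁺ {7} _ _ = sieve 8 7 4 0 1 15286072144 19551 40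
  (modulo 16 2 ∷ modulo 29 7 ∷ modulo 13721 1372 ∷ modulo 15286072144 1372 ∷ [])
large⁺⁺ {8} _ _ = sieve 9 8 2 0 1 7488 224 3 (modulo 9 2 ∷ modulo 13 4 ∷ [])
large⁺⁺ {9} _ _ = sieve 10 9 1 0 1 13869 24 22 (modulo 23 11 ∷ modulo 67 11 ∷ modulo 13869 11 ∷ [])
large⁺⁺ {10} _ _ = sieve 11 10 2 0 1 74873700 2170 36
  (modulo 11 2 ∷ modulo 27 3 ∷ modulo 2521 630 ∷ modulo 74873700 630 ∷ [])
large⁺⁺ {suc (suc (suc (suc (suc (suc (suc (suc (suc (suc (suc b))))))))))} _ b≤10 =
  contradiction b≤10 (<⇒≱ (m≤m+n 11 b))

classification⁺⁺ : ∀ n b l → 1 ≤ l → 2 ≤ b → b ≤ 10 →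
                  N n ≡ value⁺⁺ b l → Solutions⁺⁺ n b l
classification⁺⁺ = classify value⁺⁺ cutoff⁺⁺ (λ b → b + 1) 0 1
  (λ n b l → trans (+-identityʳ (N n)))
  (from-yes (small-cases? value⁺⁺ cutoff⁺⁺ solutions⁺⁺?)) large⁺⁺

value⁻⁻ : ℕ → ℕ → ℕ
value⁻⁻ b l = (b ∸ 1) * b ^ l ∸ 1

Solutions⁻⁻ : ℕ → ℕ → ℕ → Set
Solutions⁻⁻ n b l =
    (n ≡ 0 × b ≡ 2 × l ≡ 1) ⊎ (n ≡ 1 × b ≡ 2 × l ≡ 1) ⊎ (n ≡ 2 × b ≡ 2 × l ≡ 1)
  ⊎ (n ≡ 4 × b ≡ 2 × l ≡ 2) ⊎ (n ≡ 9 × b ≡ 5 × l ≡ 1) ⊎ (n ≡ 11 × b ≡ 7 × l ≡ 1)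

solutions⁻⁻? : ∀ n b l → Dec (Solutions⁻⁻ n b l)
solutions⁻⁻? n b l =
      (n ≟ 0 ×-dec b ≟ 2 ×-dec l ≟ 1) ⊎-dec (n ≟ 1 ×-dec b ≟ 2 ×-dec l ≟ 1)
  ⊎-dec (n ≟ 2 ×-dec b ≟ 2 ×-dec l ≟ 1) ⊎-dec (n ≟ 4 ×-dec b ≟ 2 ×-dec l ≟ 2)
  ⊎-dec (n ≟ 9 ×-dec b ≟ 5 ×-dec l ≟ 1) ⊎-dec (n ≟ 11 ×-dec b ≟ 7 ×-dec l ≟ 1)

solutions⁻⁻-sound : ∀ n b l → Solutions⁻⁻ n b l → N n ≡ value⁻⁻ b l
solutions⁻⁻-sound _ _ _ (inj₁ (refl , refl , refl)) = refl
solutions⁻⁻-sound _ _ _ (inj₂ (inj₁ (refl , refl , refl))) = refl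
solutions⁻⁻-sound _ _ _ (inj₂ (inj₂ (inj₁ (refl , refl , refl)))) = refl
solutions⁻⁻-sound _ _ _ (inj₂ (inj₂ (inj₂ (inj₁ (refl , refl , refl))))) = refl
solutions⁻⁻-sound _ _ _ (inj₂ (inj₂ (inj₂ (inj₂ (inj₁ (refl , refl , refl)))))) = refl
solutions⁻⁻-sound _ _ _ (inj₂ (inj₂ (inj₂ (inj₂ (inj₂ (refl , refl , refl)))))) = refl

cutoff⁻⁻ : ℕ → ℕ
cutoff⁻⁻ 2 = 4
cutoff⁻⁻ 3 = 2
cutoff⁻⁻ 4 = 2
cutoff⁻⁻ 5 = 2
cutoff⁻⁻ 6 = 2
cutoff⁻⁻ 7 = 2
cutoff⁻⁻ 8 = 1
cutoff⁻⁻ 9 = 1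
cutoff⁻⁻ 10 = 2
cutoff⁻⁻ _ = 0

large⁻⁻ : ∀ {b} → 2 ≤ b → b ≤ 10 →
         ∀ n j → N n + 1 ≢ (b ∸ 1) * b ^ (cutoff⁻⁻ b + j) + 0
large⁻⁻ {0} () _
large⁻⁻ {1} (s≤s ()) _
large⁻⁻ {2} _ _ = sieve 1 2 4 1 0 48 56 1 (modulo 3 2 ∷ [])
large⁻⁻ {3} _ _ = sieve 2 3 2 1 0 1872 24 7 (modulo 13 3 ∷ modulo 16 4 ∷ [])
large⁻⁻ {4} _ _ = sieve 3 4 2 1 0 208 56 3 (modulo 13 6 ∷ [])
large⁻⁻ {5} _ _ = sieve 4 5 2 1 0 47275 155 24 (modulo 31 3 ∷ modulo 61 30 ∷ modulo 47275 30 ∷ [])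
large⁻⁻ {6} _ _ = sieve 5 6 2 1 0 468 168 1 (modulo 13 12 ∷ [])
large⁻⁻ {7} _ _ = sieve 6 7 2 1 0 14112 399 16 (modulo 9 3 ∷ modulo 32 4 ∷ [])
large⁻⁻ {8} _ _ = sieve 7 8 1 1 0 72 28 6 (modulo 9 2 ∷ [])
large⁻⁻ {9} _ _ = sieve 8 9 1 1 0 468 24 7 (modulo 4 1 ∷ modulo 13 3 ∷ [])
large⁻⁻ {10} _ _ = sieve 9 10 2 1 0 9900 2170 12 (modulo 9 1 ∷ modulo 11 2 ∷ [])
large⁻⁻ {suc (suc (suc (suc (suc (suc (suc (suc (suc (suc (suc b))))))))))} _ b≤10 =
  contradiction b≤10 (<⇒≱ (m≤m+n 11 b))

classification⁻⁻ : ∀ n b l → 1 ≤ l → 2 ≤ b → b ≤ 10 →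
                  N n ≡ value⁻⁻ b l → Solutions⁻⁻ n b l
classification⁻⁻ = classify value⁻⁻ cutoff⁻⁻ (λ b → b ∸ 1) 1 0
  (λ n b l → m≡n∸1⇒m+1≡n+0 ((b ∸ 1) * b ^ l) (N-positive n))
  (from-yes (small-cases? value⁻⁻ cutoff⁻⁻ solutions⁻⁻?)) large⁻⁻

value⁻⁺ : ℕ → ℕ → ℕ
value⁻⁺ b l = (b ∸ 1) * b ^ l + 1

Solutions⁻⁺ : ℕ → ℕ → ℕ → Set
Solutions⁻⁺ n b l =
    (n ≡ 4 × b ≡ 2 × l ≡ 1) ⊎ (n ≡ 7 × b ≡ 2 × l ≡ 3) ⊎ (n ≡ 8 × b ≡ 4 × l ≡ 1)
  ⊎ (n ≡ 9 × b ≡ 3 × l ≡ 2) ⊎ (n ≡ 14 × b ≡ 2 × l ≡ 7)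

solutions⁻⁺? : ∀ n b l → Dec (Solutions⁻⁺ n b l)
solutions⁻⁺? n b l =
      (n ≟ 4 ×-dec b ≟ 2 ×-dec l ≟ 1) ⊎-dec (n ≟ 7 ×-dec b ≟ 2 ×-dec l ≟ 3)
  ⊎-dec (n ≟ 8 ×-dec b ≟ 4 ×-dec l ≟ 1) ⊎-dec (n ≟ 9 ×-dec b ≟ 3 ×-dec l ≟ 2)
  ⊎-dec (n ≟ 14 ×-dec b ≟ 2 ×-dec l ≟ 7)

solutions⁻⁺-sound : ∀ n b l → Solutions⁻⁺ n b l → N n ≡ value⁻⁺ b l
solutions⁻⁺-sound _ _ _ (inj₁ (refl , refl , refl)) = refl
solutions⁻⁺-sound _ _ _ (inj₂ (inj₁ (refl , refl , refl))) = refl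
solutions⁻⁺-sound _ _ _ (inj₂ (inj₂ (inj₁ (refl , refl , refl)))) = refl
solutions⁻⁺-sound _ _ _ (inj₂ (inj₂ (inj₂ (inj₁ (refl , refl , refl))))) = refl
solutions⁻⁺-sound _ _ _ (inj₂ (inj₂ (inj₂ (inj₂ (refl , refl , refl))))) = refl

cutoff⁻⁺ : ℕ → ℕ
cutoff⁻⁺ 2 = 8
cutoff⁻⁺ 3 = 4
cutoff⁻⁺ 4 = 2
cutoff⁻⁺ 5 = 2
cutoff⁻⁺ 6 = 2
cutoff⁻⁺ 7 = 2
cutoff⁻⁺ 8 = 3
cutoff⁻⁺ 9 = 2
cutoff⁻⁺ 10 = 2
cutoff⁻⁺ _ = 0

large⁻⁺ : ∀ {b} → 2 ≤ b → b ≤ 10 →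
         ∀ n j → N n + 0 ≢ (b ∸ 1) * b ^ (cutoff⁻⁺ b + j) + 1
large⁻⁺ {0} () _
large⁻⁺ {1} (s≤s ()) _
large⁻⁺ {2} _ _ = sieve 1 2 8 0 1 768 896 1 (modulo 3 2 ∷ [])
large⁻⁺ {3} _ _ = sieve 2 3 4 0 1 1596348 216 7
  (modulo 4 2 ∷ modulo 13 3 ∷ modulo 379 378 ∷ modulo 1596348 378 ∷ [])
large⁻⁺ {4} _ _ = sieve 3 4 2 0 1 1872 56 3 (modulo 9 3 ∷ modulo 13 6 ∷ [])
large⁻⁺ {5} _ _ = sieve 4 5 2 0 1 150975 155 24
  (modulo 11 5 ∷ modulo 9 6 ∷ modulo 61 30 ∷ modulo 150975 30 ∷ [])
large⁻⁺ {6} _ _ = sieve 5 6 2 0 1 12416508 168 11 (modulo 43 3 ∷ modulo 13 12 ∷ modulo 617 56 ∷ [])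
large⁻⁺ {7} _ _ = sieve 6 7 2 0 1 7056 399 8 (modulo 16 2 ∷ modulo 9 3 ∷ [])
large⁻⁺ {8} _ _ = sieve 7 8 3 0 1 1536 1792 1 (modulo 3 2 ∷ [])
large⁻⁺ {9} _ _ = sieve 8 9 2 0 1 329184 216 28 (modulo 32 4 ∷ modulo 127 63 ∷ [])
large⁻⁺ {10} _ _ = sieve 9 10 2 0 1 128700 2170 12 (modulo 9 1 ∷ modulo 11 2 ∷ modulo 13 6 ∷ [])
large⁻⁺ {suc (suc (suc (suc (suc (suc (suc (suc (suc (suc (suc b))))))))))} _ b≤10 =
  contradiction b≤10 (<⇒≱ (m≤m+n 11 b))

classification⁻⁺ : ∀ n b l → 1 ≤ l → 2 ≤ b → b ≤ 10 →
                  N n ≡ value⁻⁺ b l → Solutions⁻⁺ n b l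
classification⁻⁺ = classify value⁻⁺ cutoff⁻⁺ (λ b → b ∸ 1) 0 1
  (λ n b l → trans (+-identityʳ (N n)))
  (from-yes (small-cases? value⁻⁺ cutoff⁻⁺ solutions⁻⁺?)) large⁻⁺

theorem5p1 : (n b l : ℕ) → 1 ≤ l → 2 ≤ b → b ≤ 10 →
    ((N n ≡ (b + 1) * b ^ l ∸ 1 →
        ((n ≡ 9 × b ≡ 4 × l ≡ 1) ⊎ (n ≡ 11 × b ≡ 6 × l ≡ 1)))
     × (((n ≡ 9 × b ≡ 4 × l ≡ 1) ⊎ (n ≡ 11 × b ≡ 6 × l ≡ 1)) →
        N n ≡ (b + 1) * b ^ l ∸ 1))
    × ((N n ≡ (b + 1) * b ^ l + 1 →
        ((n ≡ 8 × b ≡ 2 × l ≡ 2) ⊎ (n ≡ 8 × b ≡ 3 × l ≡ 1) ⊎ (n ≡ 22 × b ≡ 7 × l ≡ 3)))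
     × (((n ≡ 8 × b ≡ 2 × l ≡ 2) ⊎ (n ≡ 8 × b ≡ 3 × l ≡ 1) ⊎ (n ≡ 22 × b ≡ 7 × l ≡ 3)) →
        N n ≡ (b + 1) * b ^ l + 1))
    × ((N n ≡ (b ∸ 1) * b ^ l ∸ 1 →
        ((n ≡ 0 × b ≡ 2 × l ≡ 1) ⊎ (n ≡ 1 × b ≡ 2 × l ≡ 1) ⊎ (n ≡ 2 × b ≡ 2 × l ≡ 1)
          ⊎ (n ≡ 4 × b ≡ 2 × l ≡ 2) ⊎ (n ≡ 9 × b ≡ 5 × l ≡ 1) ⊎ (n ≡ 11 × b ≡ 7 × l ≡ 1)))
     × (((n ≡ 0 × b ≡ 2 × l ≡ 1) ⊎ (n ≡ 1 × b ≡ 2 × l ≡ 1) ⊎ (n ≡ 2 × b ≡ 2 × l ≡ 1)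
          ⊎ (n ≡ 4 × b ≡ 2 × l ≡ 2) ⊎ (n ≡ 9 × b ≡ 5 × l ≡ 1) ⊎ (n ≡ 11 × b ≡ 7 × l ≡ 1)) →
        N n ≡ (b ∸ 1) * b ^ l ∸ 1))
    × ((N n ≡ (b ∸ 1) * b ^ l + 1 →
        ((n ≡ 4 × b ≡ 2 × l ≡ 1) ⊎ (n ≡ 7 × b ≡ 2 × l ≡ 3) ⊎ (n ≡ 8 × b ≡ 4 × l ≡ 1)
          ⊎ (n ≡ 9 × b ≡ 3 × l ≡ 2) ⊎ (n ≡ 14 × b ≡ 2 × l ≡ 7)))
     × (((n ≡ 4 × b ≡ 2 × l ≡ 1) ⊎ (n ≡ 7 × b ≡ 2 × l ≡ 3) ⊎ (n ≡ 8 × b ≡ 4 × l ≡ 1)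
          ⊎ (n ≡ 9 × b ≡ 3 × l ≡ 2) ⊎ (n ≡ 14 × b ≡ 2 × l ≡ 7)) →
        N n ≡ (b ∸ 1) * b ^ l + 1))
theorem5p1 n b l 1≤l 2≤b b≤10 =
    (classification⁺⁻ n b l 1≤l 2≤b b≤10 , solutions⁺⁻-sound n b l)
  , (classification⁺⁺ n b l 1≤l 2≤b b≤10 , solutions⁺⁺-sound n b l)
  , (classification⁻⁻ n b l 1≤l 2≤b b≤10 , solutions⁻⁻-sound n b l)
  , (classification⁻⁺ n b l 1≤l 2≤b b≤10 , solutions⁻⁺-sound n b l)
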